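{- For $n\ge1$ write $n=2^k+r$ with $k=\lfloor\log_2 n\rfloor$ and $0\le r<2^k$, and define a summation tree $\mu(n)$ recursively: if $r=0$, $\mu(n)$ is the pairwise-summation tree with $2^k$ leaves; if $r>0$, $\mu(n)$ is the tree whose root has the two subtrees $\mu(2^k)$ and $\mu(r)$. Let $\beta(n)$ be the largest integer such that $2^{\beta(n)}$ divides $n!$. Then the number of computationally inequivalent summations on $n$ distinct summands whose underlying tree is isomorphic to $\mu(n)$ equals $\frac{n!}{2^{\beta(n)}}$.
   Context: A summation tree is a rooted full binary tree (every node has $0$ or $2$ children). A pairwise-summation tree is a summation tree in which every internal node having $k$ descendant leaves has two children having $\lfloor k/2\rfloor$ and $\lceil k/2\rceil$ descendant leaves (for $2^k$ leaves this is the perfect binary tree of depth $k$). Two summation trees are isomorphic if one can be obtained from the other by a finite sequence of swaps of the two children (with their subtrees) of internal nodes. A summation on $n$ distinct summands is a summation tree with $n$ leaves with a bijective labelling of its leaves by the summands; two summations are computationally equivalent if one can be obtained from the other by a finite sequence of such child swaps (carrying labels along). -}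

module Defs where

open import Data.Nat using (ℕ; zero; suc; _∸_; _^_)
open import Data.Nat.Logarithm using (⌊log₂_⌋)
open import Data.Nat.Divisibility using (_∣_)
open import Data.Fin using (Fin)
open import Data.List using (List; []; _∷_; _++_; allFin)
open import Data.List.Relation.Binary.Permutation.Propositional using (_↭_)
open import Data.Product using (Σ; proj₁; _×_)
open import Data.Unit using (⊤; tt)
open import Relation.Nullary using (¬_)

data LTree (A : Set) : Set where
  leaf : A → LTree A
  node : LTree A → LTree A → LTree A

Tree : Set
Tree = LTree ⊤

shape : {A : Set} → LTree A → Tree
shape (leaf _)   = leaf tt
shape (node l r) = node (shape l) (shape r)

leaves : {A : Set} → LTree A → List A
leaves (leaf a)   = a ∷ []
leaves (node l r) = leaves l ++ leaves r

-- Equivalence generated by finite sequences of child swaps at internal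
-- nodes (carrying subtrees/labels along).  On Tree this is isomorphism,
-- on labelled trees it is computational equivalence.
data _≈_ {A : Set} : LTree A → LTree A → Set where
  ≈-refl  : ∀ {t} → t ≈ t
  ≈-sym   : ∀ {s t} → s ≈ t → t ≈ s
  ≈-trans : ∀ {s t u} → s ≈ t → t ≈ u → s ≈ u
  swap    : ∀ {l r} → node l r ≈ node r l
  congˡ   : ∀ {l l′ r} → l ≈ l′ → node l r ≈ node l′ r
  congʳ   : ∀ {l r r′} → r ≈ r′ → node l r ≈ node l r′

-- A summation on n distinct summands (the summands are Fin n):
-- a labelled tree whose leaf labelling is a bijection onto Fin n.
Summation : ℕ → Set
Summation n = Σ (LTree (Fin n)) λ t → leaves t ↭ allFin n

_≈ₛ_ : {n : ℕ} → Summation n → Summation n → Set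
s ≈ₛ t = proj₁ s ≈ proj₁ t

-- Pairwise-summation tree with 2^k leaves = perfect binary tree of depth k.
perfect : ℕ → Tree
perfect zero    = leaf tt
perfect (suc k) = node (perfect k) (perfect k)

-- μ with fuel; μ n = μ-fuel n n.  With n = 2^k + r, k = ⌊log₂ n⌋:
-- r = 0 gives the pairwise tree with 2^k leaves (= μ(2^k)),
-- r > 0 gives node μ(2^k) μ(r).  Fuel n suffices since r < n.
μ-fuel : ℕ → ℕ → Tree
μ-fuel zero    n = leaf tt
μ-fuel (suc f) n with n ∸ 2 ^ ⌊log₂ n ⌋
... | zero  = perfect ⌊log₂ n ⌋
... | suc r = node (perfect ⌊log₂ n ⌋) (μ-fuel f (suc r))

μ : ℕ → Tree
μ n = μ-fuel n n

IsLargestPow2Div : ℕ → ℕ → Set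
IsLargestPow2Div b m = (2 ^ b ∣ m) × ¬ (2 ^ suc b ∣ m)

-- Up to child swaps, a labelling of a tree T is built by distributing the labels
-- between the two subtrees and labelling each recursively; when the subtrees are
-- isomorphic the swap identifies two distributions, so one fixes the subtree that
-- receives the first label. Enumerating labellings this way yields count T classes,
-- with count T * 2 ^ s = |T|! where s is the number of nodes with isomorphic
-- children. For μ(n) the binomial coefficients occurring in count are
-- C(2^k + r, 2^k) with r < 2^k and C(2^(k+1) - 1, 2^k - 1), which are odd by Lucas's
-- theorem; hence count (μ n) is odd and 2 ^ s is the largest power of 2 dividing n!.

module Submission where

open import Defs
open import Data.Nat
  using (ℕ; zero; suc; parity; _+_; _*_; _∸_; _^_; _≤_; _<_; _/_; _!; z≤n; s≤s; s≤s⁻¹; _<?_; ⌊_/2⌋)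
open import Data.Nat.Properties
open import Data.Nat.Combinatorics using (_C_; nCk+nC[k+1]≡[n+1]C[k+1]; nCk≡n!/k![n-k]!; k![n∸k]!∣n!; nCk≡nC[n∸k])
open import Data.Nat.DivMod using (m*n/n≡m; m/n*n≡m)
open import Data.Nat.Divisibility using (_∣_; divides; ∣-trans; n∣m*n; *-cancelˡ-∣)
open import Data.Nat.Logarithm using (⌊log₂_⌋; ⌊log₂⌋-mono-≤; ⌊log₂[2^n]⌋≡n)
open import Data.Nat.Logarithm.Core using (⌊log2⌋)
open import Data.Nat.Tactic.RingSolver using (solve-∀)
open import Data.Parity.Base as ℙ using (0ℙ; 1ℙ)
import Data.Parity.Properties as ℙ
open import Data.Bool using (if_then_else_)
open import Data.List using (List; []; _∷_; _++_; length; map; concatMap; cartesianProductWith; allFin)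
open import Data.List.Properties using (length-++; length-map; length-tabulate)
open import Data.List.Membership.Propositional using (_∈_)
open import Data.List.Membership.Propositional.Properties using (∈-∃++; ∈-map⁻; ∈-++⁺ˡ; ∈-++⁻)
open import Data.List.Relation.Unary.All as All using (All; []; _∷_)
import Data.List.Relation.Unary.All.Properties as All
open import Data.List.Relation.Unary.Any as Any using (Any; here)
import Data.List.Relation.Unary.Any.Properties as Any
open import Data.List.Relation.Unary.AllPairs as AllPairs using (AllPairs; []; _∷_)
import Data.List.Relation.Unary.AllPairs.Properties as AllPairs
open import Data.List.Relation.Unary.Unique.Propositional using (Unique)
open import Data.List.Relation.Unary.Unique.Propositional.Properties using (allFin⁺)
open import Data.List.Relation.Binary.Permutation.Propositional
  using (_↭_; ↭-refl; ↭-sym; ↭-trans; ↭-prep; ↭⇒↭ₛ)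
open import Data.List.Relation.Binary.Permutation.Propositional.Properties
  using (∈-resp-↭; All-resp-↭; ↭-length; ↭-singleton-inv; ++⁺; ++⁺ˡ; ++⁺ʳ; ++-comm; shift; drop-∷)
import Data.List.Relation.Binary.Permutation.Setoid.Properties as Permₛ
open import Data.Product using (Σ; ∃-syntax; _×_; _,_; proj₁; proj₂; map₁; map₂)
open import Data.Sum using (_⊎_; inj₁; inj₂)
open import Data.Empty using (⊥; ⊥-elim)
open import Data.Unit using (tt)
open import Function using (_∘_)
open import Induction.WellFounded using (Acc; acc)
open import Relation.Binary using (tri<; tri≈; tri>)
open import Relation.Nullary using (¬_; Dec; yes; no; does; contradiction)
open import Relation.Nullary.Decidable using (_×-dec_; _⊎-dec_)
open import Relation.Binary.PropositionalEquality
  using (_≡_; _≢_; refl; sym; trans; cong; cong₂; subst; subst₂; setoid; module ≡-Reasoning)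

private
  variable
    A B D : Set

infix 4 _≅_ _≇_

_≅_ : LTree A → LTree A → Set
leaf a   ≅ leaf b   = a ≡ b
node a b ≅ node c d = (a ≅ c × b ≅ d) ⊎ (a ≅ d × b ≅ c)
_        ≅ _        = ⊥

_≇_ : LTree A → LTree A → Set
s ≇ t = ¬ s ≅ t

≅-refl : (t : LTree A) → t ≅ t
≅-refl (leaf a)   = refl
≅-refl (node l r) = inj₁ (≅-refl l , ≅-refl r)

≅-sym : {s t : LTree A} → s ≅ t → t ≅ s
≅-sym {s = leaf _}   {leaf _}   p              = sym p
≅-sym {s = node _ _} {node _ _} (inj₁ (p , q)) = inj₁ (≅-sym p , ≅-sym q)
≅-sym {s = node _ _} {node _ _} (inj₂ (p , q)) = inj₂ (≅-sym q , ≅-sym p)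

≅-trans : {s t u : LTree A} → s ≅ t → t ≅ u → s ≅ u
≅-trans {s = leaf _}   {leaf _}   {leaf _}   p              q              = trans p q
≅-trans {s = node _ _} {node _ _} {node _ _} (inj₁ (p , q)) (inj₁ (r , s)) = inj₁ (≅-trans p r , ≅-trans q s)
≅-trans {s = node _ _} {node _ _} {node _ _} (inj₁ (p , q)) (inj₂ (r , s)) = inj₂ (≅-trans p r , ≅-trans q s)
≅-trans {s = node _ _} {node _ _} {node _ _} (inj₂ (p , q)) (inj₁ (r , s)) = inj₂ (≅-trans p s , ≅-trans q r)
≅-trans {s = node _ _} {node _ _} {node _ _} (inj₂ (p , q)) (inj₂ (r , s)) = inj₁ (≅-trans p s , ≅-trans q r)

node-swap : (l r : LTree A) → node l r ≅ node r l
node-swap l r = inj₂ (≅-refl l , ≅-refl r)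

≈⇒≅ : {s t : LTree A} → s ≈ t → s ≅ t
≈⇒≅ ≈-refl        = ≅-refl _
≈⇒≅ (≈-sym p)     = ≅-sym (≈⇒≅ p)
≈⇒≅ (≈-trans p q) = ≅-trans (≈⇒≅ p) (≈⇒≅ q)
≈⇒≅ swap          = node-swap _ _
≈⇒≅ (congˡ p)     = inj₁ (≈⇒≅ p , ≅-refl _)
≈⇒≅ (congʳ p)     = inj₁ (≅-refl _ , ≈⇒≅ p)

≅⇒≈ : {s t : LTree A} → s ≅ t → s ≈ t
≅⇒≈ {s = leaf _}   {leaf _}   refl           = ≈-refl
≅⇒≈ {s = node _ _} {node _ _} (inj₁ (p , q)) = ≈-trans (congˡ (≅⇒≈ p)) (congʳ (≅⇒≈ q))
≅⇒≈ {s = node _ _} {node _ _} (inj₂ (p , q)) =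
  ≈-trans (≈-trans (congˡ (≅⇒≈ p)) (congʳ (≅⇒≈ q))) swap

≅-leaves : {s t : LTree A} → s ≅ t → leaves s ↭ leaves t
≅-leaves {s = leaf _}   {leaf _}   refl           = ↭-refl
≅-leaves {s = node _ _} {node _ _} (inj₁ (p , q)) = ++⁺ (≅-leaves p) (≅-leaves q)
≅-leaves {s = node _ _} {node c d} (inj₂ (p , q)) =
  ↭-trans (++⁺ (≅-leaves p) (≅-leaves q)) (++-comm (leaves d) (leaves c))

shape-≅ : {s t : LTree A} → s ≅ t → shape s ≅ shape t
shape-≅ {s = leaf _}   {leaf _}   _              = refl
shape-≅ {s = node _ _} {node _ _} (inj₁ (p , q)) = inj₁ (shape-≅ p , shape-≅ q)
shape-≅ {s = node _ _} {node _ _} (inj₂ (p , q)) = inj₂ (shape-≅ p , shape-≅ q)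

node-≇ : {g h g′ h′ : LTree A} → g ≇ h′ → g ≇ g′ ⊎ h ≇ h′ → node g h ≇ node g′ h′
node-≇ g≇h′ _            (inj₂ (g≅h′ , _)) = g≇h′ g≅h′
node-≇ _    (inj₁ g≇g′) (inj₁ (g≅g′ , _)) = g≇g′ g≅g′
node-≇ _    (inj₂ h≇h′) (inj₁ (_ , h≅h′)) = h≇h′ h≅h′

node-≅-symmetric⁻ : {a b S T : LTree A} → S ≅ T → node a b ≅ node S T → a ≅ S × b ≅ T
node-≅-symmetric⁻ _   (inj₁ a≅S×b≅T)     = a≅S×b≅T
node-≅-symmetric⁻ S≅T (inj₂ (a≅T , b≅S)) = ≅-trans a≅T (≅-sym S≅T) , ≅-trans b≅S S≅T

_≅?_ : (S T : Tree) → Dec (S ≅ T)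
leaf tt  ≅? leaf tt  = yes refl
leaf _   ≅? node _ _ = no λ ()
node _ _ ≅? leaf _   = no λ ()
node a b ≅? node c d = (a ≅? c ×-dec b ≅? d) ⊎-dec (a ≅? d ×-dec b ≅? c)

size : LTree A → ℕ
size t = length (leaves t)

size-node : (l r : LTree A) → size (node l r) ≡ size l + size r
size-node l r = length-++ (leaves l)

size-shape : (t : LTree A) → size (shape t) ≡ size t
size-shape (leaf _)   = refl
size-shape (node l r) = begin
  size (node (shape l) (shape r)) ≡⟨ size-node (shape l) (shape r) ⟩
  size (shape l) + size (shape r) ≡⟨ cong₂ _+_ (size-shape l) (size-shape r) ⟩
  size l + size r                 ≡⟨ size-node l r ⟨
  size (node l r)                 ∎
  where open ≡-Reasoning

size-pos : (t : LTree A) → 1 ≤ size t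
size-pos (leaf _)   = s≤s z≤n
size-pos (node l r) = subst (1 ≤_) (sym (size-node l r)) (≤-trans (size-pos l) (m≤m+n (size l) (size r)))

≅-size : {s t : LTree A} → s ≅ t → size s ≡ size t
≅-size = ↭-length ∘ ≅-leaves

size-≅-shape : (t : LTree A) {T : Tree} → shape t ≅ T → size t ≡ size T
size-≅-shape t t≅T = trans (sym (size-shape t)) (≅-size t≅T)

∈⇒↭-∷ : {x : A} {xs : List A} → x ∈ xs → ∃[ ys ] xs ↭ x ∷ ys
∈⇒↭-∷ {x = x} x∈xs with ys , zs , refl ← ∈-∃++ x∈xs = ys ++ zs , shift x ys zs

Unique-resp-↭ : {xs ys : List A} → xs ↭ ys → Unique xs → Unique ys
Unique-resp-↭ {A = A} p = Permₛ.Unique-resp-↭ (setoid A) (↭⇒↭ₛ p)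

Unique-++⁻ : (xs : List A) {ys : List A} → Unique (xs ++ ys) → Unique xs × Unique ys
Unique-++⁻ []       ys!          = [] , ys!
Unique-++⁻ (x ∷ xs) (x∉ ∷ xsys!) =
  (All.++⁻ˡ xs x∉ ∷ proj₁ (Unique-++⁻ xs xsys!)) , proj₂ (Unique-++⁻ xs xsys!)

AllPairs-zipWithAll : {P : A → Set} {R R′ : A → A → Set} →
  (∀ {x y} → P x → P y → R x y → R′ x y) → {xs : List A} → All P xs → AllPairs R xs → AllPairs R′ xs
AllPairs-zipWithAll f []         []         = []
AllPairs-zipWithAll f (px ∷ pxs) (rx ∷ rxs) =
  All.zipWith (λ (py , r) → f px py r) (pxs , rx) ∷ AllPairs-zipWithAll f pxs rxs

All-cartesianProductWith : {P : D → Set} (f : A → B → D) {xs : List A} {ys : List B} →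
  All (λ x → All (λ y → P (f x y)) ys) xs → All P (cartesianProductWith f xs ys)
All-cartesianProductWith f []         = []
All-cartesianProductWith f (px ∷ pxs) = All.++⁺ (All.map⁺ px) (All-cartesianProductWith f pxs)

length-cartesianProductWith : (f : A → B → D) (xs : List A) (ys : List B) →
  length (cartesianProductWith f xs ys) ≡ length xs * length ys
length-cartesianProductWith f []       ys = refl
length-cartesianProductWith f (x ∷ xs) ys = begin
  length (map (f x) ys ++ cartesianProductWith f xs ys)         ≡⟨ length-++ (map (f x) ys) ⟩
  length (map (f x) ys) + length (cartesianProductWith f xs ys) ≡⟨ cong₂ _+_ (length-map (f x) ys)
                                                                     (length-cartesianProductWith f xs ys) ⟩
  length ys + length xs * length ys                             ∎
  where open ≡-Reasoning

length-concatMap : (f : A → List B) {k : ℕ} {xs : List A} →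
  All (λ x → length (f x) ≡ k) xs → length (concatMap f xs) ≡ length xs * k
length-concatMap f []                 = refl
length-concatMap f {xs = x ∷ xs} (p ∷ ps) =
  trans (length-++ (f x)) (cong₂ _+_ p (length-concatMap f ps))

splits : ℕ → List A → List (List A × List A)
splits zero    xs       = ([] , xs) ∷ []
splits (suc j) []       = []
splits (suc j) (x ∷ xs) = map (map₁ (x ∷_)) (splits j xs) ++ map (map₂ (x ∷_)) (splits (suc j) xs)

Split : ℕ → List A → List A × List A → Set
Split j xs (S , R) = S ++ R ↭ xs × length S ≡ j

Covers : List A → List A → List A × List A → Set
Covers P Q (S , R) = P ↭ S × Q ↭ R

splits-sound : (j : ℕ) (xs : List A) → All (Split j xs) (splits j xs)
splits-sound zero    xs       = (↭-refl , refl) ∷ []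
splits-sound (suc j) []       = []
splits-sound (suc j) (x ∷ xs) = All.++⁺
  (All.map⁺ (All.map (λ (p , |S|) → ↭-prep x p , cong suc |S|) (splits-sound j xs)))
  (All.map⁺ (All.map (λ {(S , R)} (p , |S|) → ↭-trans (shift x S R) (↭-prep x p) , |S|) (splits-sound (suc j) xs)))

length-splits : (j : ℕ) (xs : List A) → length (splits j xs) ≡ length xs C j
length-splits zero    xs       = refl
length-splits (suc j) []       = refl
length-splits (suc j) (x ∷ xs) = begin
  length (map (map₁ (x ∷_)) (splits j xs) ++ map (map₂ (x ∷_)) (splits (suc j) xs))
    ≡⟨ length-++ (map (map₁ (x ∷_)) (splits j xs)) ⟩
  length (map (map₁ (x ∷_)) (splits j xs)) + length (map (map₂ (x ∷_)) (splits (suc j) xs))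
    ≡⟨ cong₂ _+_ (trans (length-map _ (splits j xs)) (length-splits j xs))
                 (trans (length-map _ (splits (suc j) xs)) (length-splits (suc j) xs)) ⟩
  length xs C j + length xs C suc j
    ≡⟨ nCk+nC[k+1]≡[n+1]C[k+1] (length xs) j ⟩
  suc (length xs) C suc j
    ∎
  where open ≡-Reasoning

splits-complete : (j : ℕ) (xs : List A) {P Q : List A} → P ++ Q ↭ xs → length P ≡ j →
  Any (Covers P Q) (splits j xs)
splits-complete zero    xs       {[]}    PQ↭xs _ = here (↭-refl , PQ↭xs)
splits-complete (suc j) []       {y ∷ P} PQ↭[] _ with () ← ↭-length PQ↭[]
splits-complete (suc j) (x ∷ xs) {P} {Q} PQ↭xs |P| with ∈-++⁻ P (∈-resp-↭ (↭-sym PQ↭xs) (here refl))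
... | inj₁ x∈P with P′ , P↭ ← ∈⇒↭-∷ x∈P =
  Any.++⁺ˡ (Any.map⁺ (Any.map (λ (p , q) → ↭-trans P↭ (↭-prep x p) , q)
    (splits-complete j xs (drop-∷ (↭-trans (++⁺ʳ Q (↭-sym P↭)) PQ↭xs))
                          (suc-injective (trans (sym (↭-length P↭)) |P|)))))
... | inj₂ x∈Q with Q′ , Q↭ ← ∈⇒↭-∷ x∈Q =
  Any.++⁺ʳ _ (Any.map⁺ (Any.map (λ (p , q) → p , ↭-trans Q↭ (↭-prep x q))
    (splits-complete (suc j) xs
      (drop-∷ (↭-trans (↭-sym (shift x P Q′)) (↭-trans (++⁺ˡ P (↭-sym Q↭)) PQ↭xs))) |P|)))

Split-left-⊆ : {j : ℕ} {xs S R : List A} {z : A} → Split j xs (S , R) → z ∈ S → z ∈ xs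
Split-left-⊆ (p , _) z∈S = ∈-resp-↭ p (∈-++⁺ˡ z∈S)

splits-distinct : (j : ℕ) (xs : List A) → Unique xs →
  AllPairs (λ c d → ¬ (proj₁ c ↭ proj₁ d)) (splits j xs)
splits-distinct zero    xs       _             = [] ∷ []
splits-distinct (suc j) []       _             = []
splits-distinct (suc j) (x ∷ xs) (x∉xs ∷ xs!) = AllPairs.++⁺
  (AllPairs.map⁺ (AllPairs.map (λ S≁S′ → S≁S′ ∘ drop-∷) (splits-distinct j xs xs!)))
  (AllPairs.map⁺ (splits-distinct (suc j) xs xs!))
  (All.map⁺ (All.universal (λ _ → All.map⁺ (All.map x∉ (splits-sound (suc j) xs))) (splits j xs)))
  where
  x∉ : ∀ {S S′ R} → Split (suc j) xs (S′ , R) → ¬ (x ∷ S ↭ S′)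
  x∉ split x∷S↭S′ = All.lookup x∉xs (Split-left-⊆ split (∈-resp-↭ x∷S↭S′ (here refl))) refl

Split-unique : {j : ℕ} {xs S R : List A} → Unique xs → Split j xs (S , R) → Unique S × Unique R
Split-unique {S = S} xs! (p , _) = Unique-++⁻ S (Unique-resp-↭ (↭-sym p) xs!)

Split-length-right : {a b : ℕ} {xs L R : List A} → Split a xs (L , R) → length xs ≡ a + b → length R ≡ b
Split-length-right {a = a} {b} {xs} {L} {R} (LR↭xs , |L|) |xs| = +-cancelˡ-≡ a _ _ (begin
  a + length R        ≡⟨ cong (_+ length R) |L| ⟨
  length L + length R ≡⟨ length-++ L ⟨
  length (L ++ R)     ≡⟨ ↭-length LR↭xs ⟩
  length xs           ≡⟨ |xs| ⟩
  a + b               ∎)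
  where open ≡-Reasoning

-- Enumerating labelled trees of a given shape up to isomorphism

nodes : (List A → List (LTree A)) → (List A → List (LTree A)) → List (List A × List A) → List (LTree A)
nodes enumˡ enumʳ = concatMap λ (S , R) → cartesianProductWith node (enumˡ S) (enumʳ R)

-- If the two subtrees are isomorphic, swapping them is a symmetry, which is
-- broken by putting the first label into the left subtree.
choices : {P : Set} → Dec P → ℕ → List A → List (List A × List A)
choices (no _)  a       xs       = splits a xs
choices (yes _) zero    _        = []
choices (yes _) (suc a) []       = []
choices (yes _) (suc a) (x ∷ xs) = map (map₁ (x ∷_)) (splits a xs)

enumerate : Tree → List A → List (LTree A)
enumerate (leaf _)   (x ∷ []) = leaf x ∷ []
enumerate (leaf _)   _        = []
enumerate (node S T) xs       = nodes (enumerate S) (enumerate T) (choices (S ≅? T) (size S) xs)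

IsLabelling : Tree → List A → LTree A → Set
IsLabelling T xs t = shape t ≡ T × leaves t ↭ xs

Separated : List (LTree A) → List (LTree A) → Set
Separated gs hs = All (λ g → All (g ≇_) hs) gs

choices-sound : {P : Set} (d : Dec P) (a : ℕ) (xs : List A) → All (Split a xs) (choices d a xs)
choices-sound (no _)  a       xs       = splits-sound a xs
choices-sound (yes _) zero    _        = []
choices-sound (yes _) (suc a) []       = []
choices-sound (yes _) (suc a) (x ∷ xs) =
  All.map⁺ (All.map (λ (p , |S|) → ↭-prep x p , cong suc |S|) (splits-sound a xs))

choices-distinct : {P : Set} (d : Dec P) (a : ℕ) (xs : List A) → Unique xs →
  AllPairs (λ c c′ → ¬ (proj₁ c ↭ proj₁ c′)) (choices d a xs)
choices-distinct (no _)  a       xs       xs!        = splits-distinct a xs xs!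
choices-distinct (yes _) zero    _        _          = []
choices-distinct (yes _) (suc a) []       _          = []
choices-distinct (yes _) (suc a) (x ∷ xs) (_ ∷ xs!) =
  AllPairs.map⁺ (AllPairs.map (λ S≁S′ → S≁S′ ∘ drop-∷) (splits-distinct a xs xs!))

choices-anchored : {P : Set} (p : P) (a : ℕ) (xs : List A) → Unique xs →
  ∀ {c c′} → c ∈ choices (yes p) a xs → c′ ∈ choices (yes p) a xs →
  ∃[ x ] x ∈ proj₁ c × All (x ≢_) (proj₂ c′)
choices-anchored p (suc a) (x ∷ xs) (x∉xs ∷ _) c∈ c′∈
  with _ , _ , refl ← ∈-map⁻ (map₁ (x ∷_)) c∈
     | (S′ , R′) , c′∈splits , refl ← ∈-map⁻ (map₁ (x ∷_)) c′∈
  = x , here refl , All.++⁻ʳ S′ (All-resp-↭ (↭-sym (proj₁ (All.lookup (splits-sound a xs) c′∈splits))) x∉xs)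

anchored-choices-complete : {P : Set} (p : P) (a : ℕ) (x : A) (xs : List A) {L R : List A} →
  L ++ R ↭ x ∷ xs → x ∈ L → length L ≡ a → Any (Covers L R) (choices (yes p) a (x ∷ xs))
anchored-choices-complete p zero    x xs {[]}    _     ()  _
anchored-choices-complete p zero    x xs {_ ∷ _} _     _   ()
anchored-choices-complete p (suc a) x xs {L} {R} LR↭ x∈L |L| with L′ , L↭ ← ∈⇒↭-∷ x∈L =
  Any.map⁺ (Any.map (λ (l , r) → ↭-trans L↭ (↭-prep x l) , r)
    (splits-complete a xs (drop-∷ (↭-trans (++⁺ʳ R (↭-sym L↭)) LR↭))
                          (suc-injective (trans (sym (↭-length L↭)) |L|))))

nChoices : {P : Set} → Dec P → ℕ → ℕ → ℕ
nChoices (no _)  a       b = (a + b) C a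
nChoices (yes _) zero    b = 0
nChoices (yes _) (suc a) b = (a + b) C a

length-choices : {P : Set} (d : Dec P) (a b : ℕ) (xs : List A) → length xs ≡ a + b →
  length (choices d a xs) ≡ nChoices d a b
length-choices (no _)  a       b xs       |xs| = trans (length-splits a xs) (cong (_C a) |xs|)
length-choices (yes _) zero    b xs       _    = refl
length-choices (yes _) (suc a) b (x ∷ xs) |xs| =
  trans (length-map _ (splits a xs)) (trans (length-splits a xs) (cong (_C a) (suc-injective |xs|)))

count : Tree → ℕ
count (leaf _)   = 1
count (node S T) = nChoices (S ≅? T) (size S) (size T) * (count S * count T)

-- The automorphism group of T has order 2 ^ symmetricNodes T.
symmetricNodes : Tree → ℕ
symmetricNodes (leaf _)   = 0
symmetricNodes (node S T) = (if does (S ≅? T) then 1 else 0) + (symmetricNodes S + symmetricNodes T)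

node-separated : {g h : LTree A} {gs hs : List (LTree A)} → All (g ≇_) gs → All (g ≇_) hs →
  All (node g h ≇_) (cartesianProductWith node gs hs)
node-separated g≇gs g≇hs =
  All-cartesianProductWith node
    (All.map (λ g≇g′ → All.map (λ g≇h′ → node-≇ g≇h′ (inj₁ g≇g′)) g≇hs) g≇gs)

products-separated : {gs gs′ hs hs′ : List (LTree A)} → Separated gs gs′ → Separated gs hs′ →
  Separated (cartesianProductWith node gs hs) (cartesianProductWith node gs′ hs′)
products-separated {hs = hs} gs#gs′ gs#hs′ = All-cartesianProductWith node
  (All.zipWith (λ (g≇gs′ , g≇hs′) → All.universal (λ _ → node-separated g≇gs′ g≇hs′) hs)
    (gs#gs′ , gs#hs′))

product-distinct : {gs hs : List (LTree A)} → Separated gs hs → AllPairs _≇_ gs → AllPairs _≇_ hs →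
  AllPairs _≇_ (cartesianProductWith node gs hs)
product-distinct {gs = []}    _                []             _   = []
product-distinct {gs = g ∷ gs} {hs} (g≇hs ∷ gs#hs) (g≇gs ∷ gs!) hs! = AllPairs.++⁺
  (AllPairs.map⁺ (AllPairs-zipWithAll (λ _ g≇h′ h≇h′ → node-≇ g≇h′ (inj₂ h≇h′)) g≇hs hs!))
  (product-distinct gs#hs gs! hs!)
  (All.map⁺ (All.universal (λ _ → node-separated g≇gs g≇hs) hs))

module _ (enumˡ enumʳ : List A → List (LTree A)) (cs : List (List A × List A)) where

  All-nodes : {P : LTree A → Set} →
    All (λ (S , R) → All (λ g → All (λ h → P (node g h)) (enumʳ R)) (enumˡ S)) cs →
    All P (nodes enumˡ enumʳ cs)
  All-nodes ps = All.concat⁺ (All.map⁺ (All.map (All-cartesianProductWith node) ps))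

  Any-nodes : {l r : LTree A} →
    Any (λ (S , R) → Any (l ≅_) (enumˡ S) × Any (r ≅_) (enumʳ R)) cs →
    Any (node l r ≅_) (nodes enumˡ enumʳ cs)
  Any-nodes covered = Any.concatMap⁺ _ (Any.map (λ (l∈ , r∈) →
    Any.cartesianProductWith⁺ node (λ l≅g r≅h → inj₁ (l≅g , r≅h)) l∈ r∈) covered)

  length-nodes : {m n : ℕ} → All (λ (S , R) → length (enumˡ S) ≡ m × length (enumʳ R) ≡ n) cs →
    length (nodes enumˡ enumʳ cs) ≡ length cs * (m * n)
  length-nodes ls = length-concatMap _
    (All.map (λ {(S , R)} (|gs| , |hs|) →
      trans (length-cartesianProductWith node (enumˡ S) (enumʳ R)) (cong₂ _*_ |gs| |hs|)) ls)

  nodes-distinct :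
    (∀ {c} → c ∈ cs → AllPairs _≇_ (enumˡ (proj₁ c)) × AllPairs _≇_ (enumʳ (proj₂ c))) →
    (∀ {c c′} → c ∈ cs → c′ ∈ cs → Separated (enumˡ (proj₁ c)) (enumʳ (proj₂ c′))) →
    AllPairs (λ c c′ → Separated (enumˡ (proj₁ c)) (enumˡ (proj₁ c′))) cs →
    AllPairs _≇_ (nodes enumˡ enumʳ cs)
  nodes-distinct distinct separated leftSeparated = AllPairs.concat⁺
    (All.map⁺ (All.tabulate λ c∈ →
      product-distinct (separated c∈ c∈) (proj₁ (distinct c∈)) (proj₂ (distinct c∈))))
    (AllPairs.map⁺ (AllPairs-zipWithAll (λ c∈ c′∈ gs#gs′ → products-separated gs#gs′ (separated c∈ c′∈))
      (All.tabulate (λ c∈ → c∈)) leftSeparated))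

enumerate-sound : (T : Tree) (xs : List A) → All (IsLabelling T xs) (enumerate T xs)
enumerate-sound (leaf _)   []          = []
enumerate-sound (leaf tt)  (x ∷ [])    = (refl , ↭-refl) ∷ []
enumerate-sound (leaf _)   (_ ∷ _ ∷ _) = []
enumerate-sound (node S T) xs          =
  All-nodes (enumerate S) (enumerate T) _ (All.map labelled (choices-sound (S ≅? T) (size S) xs))
  where
  labelled : ∀ {c} → Split (size S) xs c →
    All (λ g → All (λ h → IsLabelling (node S T) xs (node g h)) (enumerate T (proj₂ c))) (enumerate S (proj₁ c))
  labelled (LR↭xs , _) = All.map (λ (gS , g↭) → All.map (λ (hT , h↭) →
    cong₂ node gS hT , ↭-trans (++⁺ g↭ h↭) LR↭xs) (enumerate-sound T _)) (enumerate-sound S _)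

enumerate-separated : (S T : Tree) (X Y : List A) →
  (∀ {g h} → IsLabelling S X g → IsLabelling T Y h → g ≇ h) → Separated (enumerate S X) (enumerate T Y)
enumerate-separated S T X Y ≇ = All.map (λ g → All.map (≇ g) (enumerate-sound T Y)) (enumerate-sound S X)

labellings-≇ : {S T : Tree} {X Y : List A} {g h : LTree A} →
  ¬ (X ↭ Y) → IsLabelling S X g → IsLabelling T Y h → g ≇ h
labellings-≇ X≁Y (_ , g↭) (_ , h↭) g≅h = X≁Y (↭-trans (↭-sym g↭) (↭-trans (≅-leaves g≅h) h↭))

enumerate-distinct : (T : Tree) (xs : List A) → Unique xs → AllPairs _≇_ (enumerate T xs)
enumerate-distinct (leaf _)   []          _   = []
enumerate-distinct (leaf _)   (_ ∷ [])    _   = [] ∷ []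
enumerate-distinct (leaf _)   (_ ∷ _ ∷ _) _   = []
enumerate-distinct (node S T) xs          xs! =
  nodes-distinct (enumerate S) (enumerate T) _ subtrees-distinct (separated (S ≅? T))
    (AllPairs.map (λ L≁L′ → enumerate-separated S S _ _ (labellings-≇ L≁L′))
      (choices-distinct (S ≅? T) (size S) xs xs!))
  where
  subtrees-distinct : ∀ {c} → c ∈ choices (S ≅? T) (size S) xs →
    AllPairs _≇_ (enumerate S (proj₁ c)) × AllPairs _≇_ (enumerate T (proj₂ c))
  subtrees-distinct c∈ with L! , R! ← Split-unique xs! (All.lookup (choices-sound (S ≅? T) (size S) xs) c∈) =
    enumerate-distinct S _ L! , enumerate-distinct T _ R!

  separated : (d : Dec (S ≅ T)) → ∀ {c c′} → c ∈ choices d (size S) xs → c′ ∈ choices d (size S) xs →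
    Separated (enumerate S (proj₁ c)) (enumerate T (proj₂ c′))
  separated (no S≇T) _ _ = enumerate-separated S T _ _ λ (gS , _) (hT , _) g≅h →
    S≇T (subst₂ _≅_ gS hT (shape-≅ g≅h))
  separated (yes S≅T) c∈ c′∈ with x , x∈L , x∉R ← choices-anchored S≅T (size S) xs xs! c∈ c′∈ =
    enumerate-separated S T _ _ λ (_ , g↭) (_ , h↭) g≅h →
      All.lookup x∉R (∈-resp-↭ h↭ (∈-resp-↭ (≅-leaves g≅h) (∈-resp-↭ (↭-sym g↭) x∈L))) refl

length-enumerate : (T : Tree) (xs : List A) → length xs ≡ size T → length (enumerate T xs) ≡ count T
length-enumerate (leaf _)   (_ ∷ [])    _    = refl
length-enumerate (node S T) xs          |xs| = begin
  length (nodes (enumerate S) (enumerate T) (choices d (size S) xs))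
    ≡⟨ length-nodes (enumerate S) (enumerate T) _ (All.map sizes (choices-sound d (size S) xs)) ⟩
  length (choices d (size S) xs) * (count S * count T)
    ≡⟨ cong (_* (count S * count T)) (length-choices d (size S) (size T) xs |xs|′) ⟩
  nChoices d (size S) (size T) * (count S * count T)
    ∎
  where
  open ≡-Reasoning
  d = S ≅? T
  |xs|′ : length xs ≡ size S + size T
  |xs|′ = trans |xs| (size-node S T)
  sizes : ∀ {c} → Split (size S) xs c →
    length (enumerate S (proj₁ c)) ≡ count S × length (enumerate T (proj₂ c)) ≡ count T
  sizes {L , R} split@(_ , |L|) = length-enumerate S L |L| , length-enumerate T R (Split-length-right {L = L} split |xs|′)

enumerate-complete : (T : Tree) (xs : List A) (t : LTree A) → shape t ≅ T → leaves t ↭ xs →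
  Any (t ≅_) (enumerate T xs)
enumerate-complete (leaf _)   xs (leaf a)   _     a↭xs with refl ← ↭-singleton-inv (↭-sym a↭xs) = here refl
enumerate-complete {A = A} (node S T) xs (node l r) lr≅ST lr↭xs = complete (S ≅? T) xs lr≅ST lr↭xs
  where
  covered : ∀ {a b cs} → shape a ≅ S → shape b ≅ T → Any (Covers (leaves a) (leaves b)) cs →
    Any (node a b ≅_) (nodes (enumerate S) (enumerate T) cs)
  covered {a} {b} a≅S b≅T = Any-nodes _ _ _ ∘ Any.map λ (a↭ , b↭) →
    enumerate-complete S _ a a≅S a↭ , enumerate-complete T _ b b≅T b↭

  swapped : ∀ {ts} → Any (node r l ≅_) ts → Any (node l r ≅_) ts
  swapped = Any.map (≅-trans (node-swap l r))

  rl↭ : ∀ {zs} → leaves l ++ leaves r ↭ zs → leaves r ++ leaves l ↭ zs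
  rl↭ = ↭-trans (++-comm (leaves r) (leaves l))

  complete : (d : Dec (S ≅ T)) (zs : List A) → node (shape l) (shape r) ≅ node S T → leaves l ++ leaves r ↭ zs →
    Any (node l r ≅_) (nodes (enumerate S) (enumerate T) (choices d (size S) zs))
  complete (no _) zs (inj₁ (l≅S , r≅T)) lr↭ =
    covered l≅S r≅T (splits-complete (size S) zs lr↭ (size-≅-shape l l≅S))
  complete (no _) zs (inj₂ (l≅T , r≅S)) lr↭ =
    swapped (covered r≅S l≅T (splits-complete (size S) zs (rl↭ lr↭) (size-≅-shape r r≅S)))
  complete (yes _)   []       _   lr↭[] = ⊥-elim (<⇒≢ (size-pos (node l r)) (sym (↭-length lr↭[])))
  complete (yes S≅T) (x ∷ ys) lr≅ lr↭ with ∈-++⁻ (leaves l) (∈-resp-↭ (↭-sym lr↭) (here refl))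
  ... | inj₁ x∈l with l≅S , r≅T ← node-≅-symmetric⁻ S≅T lr≅ =
    covered l≅S r≅T (anchored-choices-complete S≅T (size S) x ys lr↭ x∈l (size-≅-shape l l≅S))
  ... | inj₂ x∈r with r≅S , l≅T ← node-≅-symmetric⁻ S≅T (≅-trans (node-swap (shape r) (shape l)) lr≅) =
    swapped (covered r≅S l≅T (anchored-choices-complete S≅T (size S) x ys (rl↭ lr↭) x∈r (size-≅-shape r r≅S)))

C-factorial : ∀ a b → ((a + b) C a) * (a ! * b !) ≡ (a + b) !
C-factorial a b = subst (λ k → ((a + b) C a) * (a ! * k !) ≡ (a + b) !) (m+n∸m≡n a b) (begin
  ((a + b) C a) * (a ! * (a + b ∸ a) !)
    ≡⟨ cong (_* (a ! * (a + b ∸ a) !)) (nCk≡n!/k![n-k]! a≤a+b) ⟩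
  (a + b) ! / (a ! * (a + b ∸ a) !) * (a ! * (a + b ∸ a) !)
    ≡⟨ m/n*n≡m (k![n∸k]!∣n! a≤a+b) ⟩
  (a + b) !
    ∎)
  where
  open ≡-Reasoning
  a≤a+b = m≤m+n a b
  instance _ = a !* (a + b ∸ a) !≢0

central-C-factorial : ∀ m → ((m + suc m) C m) * (suc m ! * suc m !) * 2 ≡ (suc m + suc m) !
central-C-factorial m = begin
  ((m + suc m) C m) * ((suc m * m !) * suc m !) * 2     ≡⟨ regroup ((m + suc m) C m) m (m !) (suc m !) ⟩
  suc (m + suc m) * (((m + suc m) C m) * (m ! * suc m !)) ≡⟨ cong (suc (m + suc m) *_) (C-factorial m (suc m)) ⟩
  suc (m + suc m) * (m + suc m) !                      ∎
  where
  open ≡-Reasoning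
  regroup : ∀ c m f g → c * ((suc m * f) * g) * 2 ≡ suc (m + suc m) * (c * (f * g))
  regroup = solve-∀

choices-factorial : {S T : Tree} (d : Dec (S ≅ T)) →
  nChoices d (size S) (size T) * (size S ! * size T !) * 2 ^ (if does d then 1 else 0) ≡ (size S + size T) !
choices-factorial {S} {T} (no _)    = trans (*-identityʳ _) (C-factorial (size S) (size T))
choices-factorial {S} {T} (yes S≅T) rewrite sym (≅-size S≅T) with size S | size-pos S
... | suc m | _ = central-C-factorial m

count-factorial : (T : Tree) → count T * 2 ^ symmetricNodes T ≡ size T !
count-factorial (leaf _)   = refl
count-factorial (node S T) = begin
  nChoices d a b * (count S * count T) * 2 ^ (symmetric + (symmetricNodes S + symmetricNodes T))
    ≡⟨ regroup (nChoices d a b) (count S) (count T) symmetric (symmetricNodes S) (symmetricNodes T) ⟩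
  nChoices d a b * ((count S * 2 ^ symmetricNodes S) * (count T * 2 ^ symmetricNodes T)) * 2 ^ symmetric
    ≡⟨ cong (λ x → nChoices d a b * x * 2 ^ symmetric) (cong₂ _*_ (count-factorial S) (count-factorial T)) ⟩
  nChoices d a b * (a ! * b !) * 2 ^ symmetric
    ≡⟨ choices-factorial d ⟩
  (a + b) !
    ≡⟨ cong _! (size-node S T) ⟨
  size (node S T) !
    ∎
  where
  open ≡-Reasoning
  d = S ≅? T
  a = size S
  b = size T
  symmetric = if does d then 1 else 0
  regroup : ∀ x p q f e e′ → x * (p * q) * 2 ^ (f + (e + e′)) ≡ x * ((p * 2 ^ e) * (q * 2 ^ e′)) * 2 ^ f
  regroup x p q f e e′ rewrite ^-distribˡ-+-* 2 f (e + e′) | ^-distribˡ-+-* 2 e e′ =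
    rearrange x p q (2 ^ f) (2 ^ e) (2 ^ e′)
    where
    rearrange : ∀ x p q u v w → x * (p * q) * (u * (v * w)) ≡ x * ((p * v) * (q * w)) * u
    rearrange = solve-∀

-- Parity of binomial coefficients

Odd : ℕ → Set
Odd n = parity n ≡ 1ℙ

Odd-* : ∀ m n → Odd m → Odd n → Odd (m * n)
Odd-* m n m-odd n-odd = trans (ℙ.*-homo-* m n) (cong₂ ℙ._*_ m-odd n-odd)

double : ℕ → ℕ
double zero    = zero
double (suc n) = suc (suc (double n))

double≡2* : ∀ n → double n ≡ 2 * n
double≡2* zero    = refl
double≡2* (suc n) = trans (cong (suc ∘ suc) (double≡2* n)) (sym (*-suc 2 n))

double-+ : ∀ m n → double (m + n) ≡ double m + double n
double-+ zero    n = refl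
double-+ (suc m) n = cong (suc ∘ suc) (double-+ m n)

data Halving : ℕ → Set where
  even : ∀ n → Halving (double n)
  odd  : ∀ n → Halving (suc (double n))

halving : ∀ n → Halving n
halving zero = even zero
halving (suc n) with halving n
... | even m = odd m
... | odd m  = even (suc m)

parity-pascal : ∀ n k → parity (suc n C suc k) ≡ parity (n C k) ℙ.+ parity (n C suc k)
parity-pascal n k = trans (cong parity (sym (nCk+nC[k+1]≡[n+1]C[k+1] n k))) (ℙ.+-homo-+ (n C k) (n C suc k))

-- Lucas's theorem modulo 2, one case for each pair of last binary digits.
mutual
  parity-C-even-even : ∀ m j → parity (double m C double j) ≡ parity (m C j)
  parity-C-even-even zero    zero    = refl
  parity-C-even-even zero    (suc j) = refl
  parity-C-even-even (suc m) zero    = refl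
  parity-C-even-even (suc m) (suc j) = begin
    parity (double (suc m) C double (suc j))
      ≡⟨ parity-pascal (suc (double m)) (suc (double j)) ⟩
    parity (suc (double m) C suc (double j)) ℙ.+ parity (suc (double m) C double (suc j))
      ≡⟨ cong₂ ℙ._+_ (parity-C-odd-odd m j) (parity-C-odd-even m (suc j)) ⟩
    parity (m C j) ℙ.+ parity (m C suc j)
      ≡⟨ parity-pascal m j ⟨
    parity (suc m C suc j)
      ∎
    where open ≡-Reasoning

  parity-C-even-odd : ∀ m j → parity (double m C suc (double j)) ≡ 0ℙ
  parity-C-even-odd zero    j = refl
  parity-C-even-odd (suc m) j = begin
    parity (double (suc m) C suc (double j))
      ≡⟨ parity-pascal (suc (double m)) (double j) ⟩
    parity (suc (double m) C double j) ℙ.+ parity (suc (double m) C suc (double j))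
      ≡⟨ cong₂ ℙ._+_ (parity-C-odd-even m j) (parity-C-odd-odd m j) ⟩
    parity (m C j) ℙ.+ parity (m C j)
      ≡⟨ ℙ.p+p≡0ℙ (parity (m C j)) ⟩
    0ℙ
      ∎
    where open ≡-Reasoning

  parity-C-odd-even : ∀ m j → parity (suc (double m) C double j) ≡ parity (m C j)
  parity-C-odd-even m zero    = refl
  parity-C-odd-even m (suc j) = trans (parity-pascal (double m) (suc (double j)))
    (cong₂ ℙ._+_ (parity-C-even-odd m j) (parity-C-even-even m (suc j)))

  parity-C-odd-odd : ∀ m j → parity (suc (double m) C suc (double j)) ≡ parity (m C j)
  parity-C-odd-odd m j = trans (parity-pascal (double m) (double j))
    (trans (cong₂ ℙ._+_ (parity-C-even-even m j) (parity-C-even-odd m j)) (ℙ.+-identityʳ (parity (m C j))))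

double-cancel-< : ∀ {i n} → double i < 2 * n → i < n
double-cancel-< {i} {n} i< = *-cancelˡ-< 2 i n (subst (_< 2 * n) (double≡2* i) i<)

2*m+double[n]≡double[m+n] : ∀ m n → 2 * m + double n ≡ double (m + n)
2*m+double[n]≡double[m+n] m n = trans (cong (_+ double n) (sym (double≡2* m))) (sym (double-+ m n))

odd-C-2^k : ∀ k r → r < 2 ^ k → Odd ((2 ^ k + r) C 2 ^ k)
odd-C-2^k zero    zero    _          = refl
odd-C-2^k zero    (suc r) (s≤s ())
odd-C-2^k (suc k) r       r< with halving r
... | even i = begin
  parity ((2 ^ suc k + double i) C 2 ^ suc k)
    ≡⟨ cong₂ (λ n j → parity (n C j)) (2*m+double[n]≡double[m+n] (2 ^ k) i) (sym (double≡2* (2 ^ k))) ⟩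
  parity (double (2 ^ k + i) C double (2 ^ k))
    ≡⟨ parity-C-even-even (2 ^ k + i) (2 ^ k) ⟩
  parity ((2 ^ k + i) C 2 ^ k)
    ≡⟨ odd-C-2^k k i (double-cancel-< r<) ⟩
  1ℙ
    ∎
  where open ≡-Reasoning
... | odd i = begin
  parity ((2 ^ suc k + suc (double i)) C 2 ^ suc k)
    ≡⟨ cong₂ (λ n j → parity (n C j))
         (trans (+-suc (2 ^ suc k) (double i)) (cong suc (2*m+double[n]≡double[m+n] (2 ^ k) i)))
         (sym (double≡2* (2 ^ k))) ⟩
  parity (suc (double (2 ^ k + i)) C double (2 ^ k))
    ≡⟨ parity-C-odd-even (2 ^ k + i) (2 ^ k) ⟩
  parity ((2 ^ k + i) C 2 ^ k)
    ≡⟨ odd-C-2^k k i (double-cancel-< (<-trans (n<1+n _) r<)) ⟩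
  1ℙ
    ∎
  where open ≡-Reasoning

-- The trees μ(n)

size-perfect : ∀ k → size (perfect k) ≡ 2 ^ k
size-perfect zero    = refl
size-perfect (suc k) = begin
  size (node (perfect k) (perfect k))     ≡⟨ size-node (perfect k) (perfect k) ⟩
  size (perfect k) + size (perfect k)     ≡⟨ cong₂ _+_ (size-perfect k) (size-perfect k) ⟩
  2 ^ k + 2 ^ k                           ≡⟨ cong (2 ^ k +_) (+-identityʳ (2 ^ k)) ⟨
  2 ^ suc k                               ∎
  where open ≡-Reasoning

central-C-symmetric : ∀ m → (m + suc m) C m ≡ (suc m + m) C suc m
central-C-symmetric m = begin
  (m + suc m) C m               ≡⟨ nCk≡nC[n∸k] (m≤m+n m (suc m)) ⟩
  (m + suc m) C (m + suc m ∸ m) ≡⟨ cong₂ _C_ (+-comm m (suc m)) (m+n∸m≡n m (suc m)) ⟩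
  (suc m + m) C suc m           ∎
  where open ≡-Reasoning

odd-central-C : {P : Set} (p : P) (k : ℕ) → Odd (nChoices (yes p) (2 ^ k) (2 ^ k))
odd-central-C p k with 2 ^ k in 2^k≡ | m^n>0 2 k
... | suc m | _ = subst Odd (sym (central-C-symmetric m))
  (subst (λ a → Odd ((a + m) C a)) 2^k≡ (odd-C-2^k k m (subst (m <_) (sym 2^k≡) (n<1+n m))))

odd-count-node : (S T : Tree) → Odd (nChoices (S ≅? T) (size S) (size T)) → Odd (count S) → Odd (count T) →
  Odd (count (node S T))
odd-count-node S T choices-odd S-odd T-odd = Odd-* (nChoices (S ≅? T) (size S) (size T)) (count S * count T)
  choices-odd (Odd-* (count S) (count T) S-odd T-odd)

odd-count-perfect : ∀ k → Odd (count (perfect k))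
odd-count-perfect zero = refl
odd-count-perfect (suc k) =
  odd-count-node (perfect k) (perfect k) (odd-choices (perfect k ≅? perfect k)) (odd-count-perfect k) (odd-count-perfect k)
  where
  odd-choices : (d : Dec (perfect k ≅ perfect k)) → Odd (nChoices d (size (perfect k)) (size (perfect k)))
  odd-choices (no P≇P)  = contradiction (≅-refl (perfect k)) P≇P
  odd-choices (yes P≅P) = subst (λ a → Odd (nChoices (yes P≅P) a a)) (sym (size-perfect k)) (odd-central-C P≅P k)

double⌊n/2⌋≤n : ∀ n → double ⌊ n /2⌋ ≤ n
double⌊n/2⌋≤n zero          = z≤n
double⌊n/2⌋≤n (suc zero)    = z≤n
double⌊n/2⌋≤n (suc (suc n)) = s≤s (s≤s (double⌊n/2⌋≤n n))

2^⌊log2⌋≤n : ∀ n (rec : Acc _<_ n) → 1 ≤ n → 2 ^ ⌊log2⌋ n rec ≤ n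
2^⌊log2⌋≤n (suc zero)    _        _ = ≤-refl
2^⌊log2⌋≤n (suc (suc n)) (acc rs) _ = begin
  2 * 2 ^ ⌊log2⌋ (suc ⌊ n /2⌋) (rs (⌊n/2⌋<n (suc n)))
    ≤⟨ *-monoʳ-≤ 2 (2^⌊log2⌋≤n (suc ⌊ n /2⌋) _ (s≤s z≤n)) ⟩
  2 * suc ⌊ n /2⌋
    ≡⟨ double≡2* (suc ⌊ n /2⌋) ⟨
  double (suc ⌊ n /2⌋)
    ≤⟨ s≤s (s≤s (double⌊n/2⌋≤n n)) ⟩
  suc (suc n)
    ∎
  where open ≤-Reasoning

2^⌊log₂n⌋≤n : ∀ {n} → 1 ≤ n → 2 ^ ⌊log₂ n ⌋ ≤ n
2^⌊log₂n⌋≤n {n} = 2^⌊log2⌋≤n n _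

n<2^[1+⌊log₂n⌋] : ∀ n → n < 2 ^ suc ⌊log₂ n ⌋
n<2^[1+⌊log₂n⌋] n with n <? 2 ^ suc ⌊log₂ n ⌋
... | yes n< = n<
... | no n≮ = contradiction
  (subst (_≤ ⌊log₂ n ⌋) (⌊log₂[2^n]⌋≡n (suc ⌊log₂ n ⌋)) (⌊log₂⌋-mono-≤ (≮⇒≥ n≮))) 1+n≰n

n∸2^⌊log₂n⌋<2^⌊log₂n⌋ : ∀ n → n ∸ 2 ^ ⌊log₂ n ⌋ < 2 ^ ⌊log₂ n ⌋
n∸2^⌊log₂n⌋<2^⌊log₂n⌋ n = m<n+o⇒m∸n<o n (2 ^ k) {{m^n≢0 2 k}}
  (subst (n <_) (cong (2 ^ k +_) (+-identityʳ (2 ^ k))) (n<2^[1+⌊log₂n⌋] n))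
  where k = ⌊log₂ n ⌋

μ-fuel-spec : ∀ f n → 1 ≤ n → n ≤ f → size (μ-fuel f n) ≡ n × Odd (count (μ-fuel f n))
μ-fuel-spec zero    n 1≤n n≤0 = contradiction (≤-trans 1≤n n≤0) λ ()
μ-fuel-spec (suc f) n 1≤n n≤1+f with n ∸ 2 ^ ⌊log₂ n ⌋ in n∸2^k≡
... | zero  =
  trans (size-perfect k) (≤-antisym (2^⌊log₂n⌋≤n 1≤n) (m∸n≡0⇒m≤n n∸2^k≡)) , odd-count-perfect k
  where k = ⌊log₂ n ⌋
... | suc r = size≡n , odd-count-node P M (odd-choices (P ≅? M)) (odd-count-perfect k) (proj₂ ih)
  where
  k = ⌊log₂ n ⌋
  P = perfect k
  M = μ-fuel f (suc r)
  2^k+r≡n : 2 ^ k + suc r ≡ n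
  2^k+r≡n = trans (cong (2 ^ k +_) (sym n∸2^k≡)) (m+[n∸m]≡n (2^⌊log₂n⌋≤n 1≤n))
  r<2^k : suc r < 2 ^ k
  r<2^k = subst (_< 2 ^ k) n∸2^k≡ (n∸2^⌊log₂n⌋<2^⌊log₂n⌋ n)
  ih : size M ≡ suc r × Odd (count M)
  ih = μ-fuel-spec f (suc r) (s≤s z≤n)
    (s≤s⁻¹ (≤-trans (subst (suc r <_) 2^k+r≡n (m<n+m (suc r) (m^n>0 2 k))) n≤1+f))
  size≡n : size (node P M) ≡ n
  size≡n = trans (size-node P M) (trans (cong₂ _+_ (size-perfect k) (proj₁ ih)) 2^k+r≡n)
  odd-choices : (d : Dec (P ≅ M)) → Odd (nChoices d (size P) (size M))
  odd-choices (yes P≅M) = contradiction (trans (sym (size-perfect k)) (trans (≅-size P≅M) (proj₁ ih))) (>⇒≢ r<2^k)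
  odd-choices (no _)    = subst₂ (λ a b → Odd ((a + b) C a)) (sym (size-perfect k)) (sym (proj₁ ih))
    (odd-C-2^k k (suc r) r<2^k)

μ-spec : ∀ n → 1 ≤ n → size (μ n) ≡ n × Odd (count (μ n))
μ-spec n 1≤n = μ-fuel-spec n n 1≤n ≤-refl

-- The 2-adic valuation of n!

m^i∣m^j : ∀ m {i j} → i ≤ j → m ^ i ∣ m ^ j
m^i∣m^j m {i} {j} i≤j = divides (m ^ (j ∸ i)) (begin
  m ^ j               ≡⟨ cong (m ^_) (m+[n∸m]≡n i≤j) ⟨
  m ^ (i + (j ∸ i))   ≡⟨ ^-distribˡ-+-* m i (j ∸ i) ⟩
  m ^ i * m ^ (j ∸ i) ≡⟨ *-comm (m ^ i) (m ^ (j ∸ i)) ⟩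
  m ^ (j ∸ i) * m ^ i ∎)
  where open ≡-Reasoning

Odd⇒¬2∣ : ∀ n → Odd n → ¬ 2 ∣ n
Odd⇒¬2∣ n n-odd (divides q n≡q*2)
  with () ← trans (sym n-odd) (trans (cong parity n≡q*2) (trans (ℙ.*-homo-* q 2) (ℙ.*-zeroʳ (parity q))))

IsLargestPow2Div[odd*2^e]⇒≡e : ∀ m {e β} → Odd m → IsLargestPow2Div β (m * 2 ^ e) → β ≡ e
IsLargestPow2Div[odd*2^e]⇒≡e m {e} {β} m-odd (2^β∣ , 2^1+β∤) with <-cmp β e
... | tri≈ _ β≡e _ = β≡e
... | tri< β<e _ _ = contradiction (∣-trans (m^i∣m^j 2 β<e) (n∣m*n m)) 2^1+β∤
... | tri> _ _ β>e = contradiction (*-cancelˡ-∣ (2 ^ e) {{m^n≢0 2 e}} 2^e*2∣2^e*m) (Odd⇒¬2∣ m m-odd)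
  where
  2^e*2∣2^e*m : 2 ^ e * 2 ∣ 2 ^ e * m
  2^e*2∣2^e*m = subst₂ _∣_ (*-comm 2 (2 ^ e)) (*-comm m (2 ^ e)) (∣-trans (m^i∣m^j 2 β>e) 2^β∣)

map-proj₁-toList : {P : A → Set} {xs : List A} (pxs : All P xs) → map proj₁ (All.toList pxs) ≡ xs
map-proj₁-toList []         = refl
map-proj₁-toList (px ∷ pxs) = cong (_ ∷_) (map-proj₁-toList pxs)

summations-classified : ∀ n T → size T ≡ n → Σ (List (Summation n)) λ reps →
  All (λ s → shape (proj₁ s) ≈ T) reps
  × AllPairs (λ s t → ¬ (s ≈ₛ t)) reps
  × (∀ (s : Summation n) → shape (proj₁ s) ≈ T → Any (λ t → s ≈ₛ t) reps)
  × length reps ≡ count T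
summations-classified n T |T|≡n = reps , shapes , distinct , complete , |reps|≡count
  where
  xs = allFin n
  labelled = enumerate-sound T xs
  reps : List (Summation n)
  reps = All.toList (All.map proj₂ labelled)
  trees : map proj₁ reps ≡ enumerate T xs
  trees = map-proj₁-toList (All.map proj₂ labelled)
  shapes = All.map⁻ (subst (All (λ t → shape t ≈ T)) (sym trees)
    (All.map (λ (shape≡ , _) → subst (shape _ ≈_) shape≡ ≈-refl) labelled))
  distinct = AllPairs.map⁻ (subst (AllPairs (λ s t → ¬ (s ≈ t))) (sym trees)
    (AllPairs.map (λ s≇t → s≇t ∘ ≈⇒≅) (enumerate-distinct T xs (allFin⁺ n))))
  complete : ∀ (s : Summation n) → shape (proj₁ s) ≈ T → Any (λ t → s ≈ₛ t) reps
  complete (t , t↭xs) t≈T = Any.map⁻ (subst (Any (t ≈_)) (sym trees)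
    (Any.map ≅⇒≈ (enumerate-complete T xs t (≈⇒≅ t≈T) t↭xs)))
  |reps|≡count = begin
    length reps                ≡⟨ length-map proj₁ reps ⟨
    length (map proj₁ reps)    ≡⟨ cong length trees ⟩
    length (enumerate T xs)    ≡⟨ length-enumerate T xs (trans (length-tabulate _) (sym |T|≡n)) ⟩
    count T                    ∎
    where open ≡-Reasoning

proposition22 : (n : ℕ) → 1 ≤ n → (β : ℕ) → IsLargestPow2Div β (n !) →
    Σ (List (Summation n)) λ reps →
      All (λ s → shape (proj₁ s) ≈ μ n) reps
      × AllPairs (λ s t → ¬ (s ≈ₛ t)) reps
      × (∀ (s : Summation n) → shape (proj₁ s) ≈ μ n → Any (λ t → s ≈ₛ t) reps)
      × length reps ≡ _/_ (n !) (2 ^ β) {{m^n≢0 2 β}}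
proposition22 n 1≤n β β-largest with summations-classified n (μ n) (proj₁ (μ-spec n 1≤n))
... | reps , shapes , distinct , complete , |reps|≡count = reps , shapes , distinct , complete , (begin
  length reps                 ≡⟨ |reps|≡count ⟩
  count (μ n)                 ≡⟨ m*n/n≡m (count (μ n)) (2 ^ β) ⟨
  count (μ n) * 2 ^ β / 2 ^ β ≡⟨ cong (_/ 2 ^ β) count*2^β≡n! ⟩
  n ! / 2 ^ β                 ∎)
  where
  open ≡-Reasoning
  instance _ = m^n≢0 2 β
  μn = μ-spec n 1≤n
  count*2^e≡n! : count (μ n) * 2 ^ symmetricNodes (μ n) ≡ n !
  count*2^e≡n! = trans (count-factorial (μ n)) (cong _! (proj₁ μn))
  β≡e : β ≡ symmetricNodes (μ n)
  β≡e = IsLargestPow2Div[odd*2^e]⇒≡e (count (μ n)) (proj₂ μn)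
    (subst (IsLargestPow2Div β) (sym count*2^e≡n!) β-largest)
  count*2^β≡n! : count (μ n) * 2 ^ β ≡ n !
  count*2^β≡n! = subst (λ e → count (μ n) * 2 ^ e ≡ n !) (sym β≡e) count*2^e≡n!
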